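{- Let $(X,\sigma,\tau)$ be a solution such that for every $x\in X$ there is $y\in X$ with $\sigma_y(x)=x$, and for every $x\in X$ there is $y\in X$ with $\tau_y(x)=x$. Then $(X,\sigma,\tau)$ is a multipermutation solution of level at most $2$ if and only if it is $2$-reductive.
   Context: A solution is a triple $(X,\sigma,\tau)$ with $X$ a non-empty set and bijections $\sigma_x,\tau_y$ of $X$ such that $r(x,y)=(\sigma_x(y),\tau_y(x))$ is a bijection of $X^2$ satisfying $(\mathrm{id}\times r)(r\times\mathrm{id})(\mathrm{id}\times r)=(r\times\mathrm{id})(\mathrm{id}\times r)(r\times\mathrm{id})$. It is $2$-reductive if for all $x,y$: $\sigma_{\sigma_x(y)}=\sigma_y$, $\tau_{\tau_x(y)}=\tau_y$, $\sigma_{\tau_x(y)}=\sigma_y$, $\tau_{\sigma_x(y)}=\tau_y$. The relation $x\approx y$ iff ($\sigma_x=\sigma_y$ and $\tau_x=\tau_y$) is a congruence of any solution and induces the retraction solution $\mathrm{Ret}(X,\sigma,\tau)$ on $X/{\approx}$ by $\sigma_{[x]}([y])=[\sigma_x(y)]$, $\tau_{[y]}([x])=[\tau_y(x)]$. The solution is of multipermutation level at most $2$ if $\mathrm{Ret}(\mathrm{Ret}(X,\sigma,\tau))$ has exactly one element. -}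

module Defs where

open import Data.Product using (_×_; _,_; Σ)
open import Data.Nat using (ℕ; zero; suc)
open import Function.Definitions using (Bijective)
open import Relation.Binary.PropositionalEquality using (_≡_)

rMap : {X : Set} → (X → X → X) → (X → X → X) → X × X → X × X
rMap σ τ (x , y) = (σ x y , τ y x)

r×id : {X : Set} → (X × X → X × X) → X × X × X → X × X × X
r×id r (x , y , z) with r (x , y)
... | (a , b) = (a , b , z)

id×r : {X : Set} → (X × X → X × X) → X × X × X → X × X × X
id×r r (x , y , z) with r (y , z)
... | (a , b) = (x , a , b)

record Solution (X : Set) : Set where
  field
    σ : X → X → X
    τ : X → X → X
    nonempty : X
    σ-bij : ∀ x → Bijective _≡_ _≡_ (σ x)
    τ-bij : ∀ y → Bijective _≡_ _≡_ (τ y)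
    r-bij : Bijective _≡_ _≡_ (rMap σ τ)
    braid : ∀ t → id×r (rMap σ τ) (r×id (rMap σ τ) (id×r (rMap σ τ) t))
                ≡ r×id (rMap σ τ) (id×r (rMap σ τ) (r×id (rMap σ τ) t))

module _ {X : Set} (S : Solution X) where
  open Solution S

  TwoReductive : Set
  TwoReductive = ∀ x y →
      (∀ z → σ (σ x y) z ≡ σ y z)
    × (∀ z → τ (τ x y) z ≡ τ y z)
    × (∀ z → σ (τ x y) z ≡ σ y z)
    × (∀ z → τ (σ x y) z ≡ τ y z)

  -- Given an equivalence E on X presenting the carrier X/E of an iterated
  -- retraction (with the induced σ, τ), the retraction relation on X/E:
  -- [x] ~ [y] iff σ_[x] = σ_[y] and τ_[x] = τ_[y] as maps of X/E, i.e.
  -- for all z, [σ_x z] = [σ_y z] and [τ_x z] = [τ_y z].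
  RetRel : (X → X → Set) → X → X → Set
  RetRel E x y = (∀ z → E (σ x z) (σ y z)) × (∀ z → E (τ x z) (τ y z))

  -- Equivalence presenting Ret^n(X) as a quotient of X.
  RetEq : ℕ → X → X → Set
  RetEq zero    = _≡_
  RetEq (suc n) = RetRel (RetEq n)

  -- Ret(Ret(X)) has exactly one element: X is non-empty (so the quotient is),
  -- and all elements of X are identified in Ret(Ret(X)).
  MultipermutationLevel≤2 : Set
  MultipermutationLevel≤2 = ∀ x y → RetEq (suc (suc zero)) x y

{-# OPTIONS --safe #-}
module Submission where

-- Ret²(X) is trivial iff σ_x z ≈ σ_y z and τ_x z ≈ τ_y z for all x, y, z,
-- while 2-reductivity says σ_x y ≈ y and τ_x y ≈ y.  The latter gives the
-- former by transitivity of ≈; conversely, choosing x' with σ_{x'} y = y gives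
-- σ_x y ≈ σ_{x'} y = y, and likewise for τ.

open import Defs
open import Data.Product using (Σ; _×_; _,_; proj₁; proj₂)
open import Data.Product.Function.NonDependent.Propositional using (_×-⇔_)
open import Function.Bundles using (_⇔_; mk⇔)
open import Function.Properties.Equivalence using () renaming (sym to ⇔-sym; trans to ⇔-trans)
open import Relation.Binary.Definitions using (Reflexive; Symmetric; Transitive)
open import Relation.Binary.PropositionalEquality as ≡ using (_≡_)
open import Relation.Binary.Structures using (IsEquivalence)

module _ {X : Set} (S : Solution X) where
  open Solution S

  RetRel-isEquivalence : ∀ {E : X → X → Set} → IsEquivalence E → IsEquivalence (RetRel S E)
  RetRel-isEquivalence {E} isEq = record { refl = refl′ ; sym = sym′ ; trans = trans′ }
    where
    open IsEquivalence isEq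

    refl′ : Reflexive (RetRel S E)
    refl′ = (λ _ → refl) , (λ _ → refl)

    sym′ : Symmetric (RetRel S E)
    sym′ (σ≈ , τ≈) = (λ z → sym (σ≈ z)) , (λ z → sym (τ≈ z))

    trans′ : Transitive (RetRel S E)
    trans′ (σ≈ , τ≈) (σ≈′ , τ≈′) = (λ z → trans (σ≈ z) (σ≈′ z)) , (λ z → trans (τ≈ z) (τ≈′ z))

  infix 4 _≈_
  _≈_ : X → X → Set
  _≈_ = RetEq S 1

  ≈-isEquivalence : IsEquivalence _≈_
  ≈-isEquivalence = RetRel-isEquivalence ≡.isEquivalence

  open IsEquivalence ≈-isEquivalence renaming (sym to ≈-sym; trans to ≈-trans)

  Uniform : (X → X → X) → Set
  Uniform _∙_ = ∀ x x′ y → x ∙ y ≈ x′ ∙ y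

  Absorbing : (X → X → X) → Set
  Absorbing _∙_ = ∀ x y → x ∙ y ≈ y

  mpl≤2⇔uniform : MultipermutationLevel≤2 S ⇔ (Uniform σ × Uniform τ)
  mpl≤2⇔uniform = mk⇔
    (λ m → (λ x x′ → proj₁ (m x x′)) , (λ x x′ → proj₂ (m x x′)))
    (λ (σ-unif , τ-unif) x x′ → σ-unif x x′ , τ-unif x x′)

  twoReductive⇔absorbing : TwoReductive S ⇔ (Absorbing σ × Absorbing τ)
  twoReductive⇔absorbing = mk⇔ to from
    where
    to : TwoReductive S → Absorbing σ × Absorbing τ
    to r = (λ x y → let (σσ , _ , _ , τσ) = r x y in σσ , τσ)
         , (λ x y → let (_ , ττ , στ , _) = r x y in στ , ττ)

    from : Absorbing σ × Absorbing τ → TwoReductive S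
    from (σ-abs , τ-abs) x y =
      let (σσ , τσ) = σ-abs x y ; (στ , ττ) = τ-abs x y in σσ , ττ , στ , τσ

  absorbing⇒uniform : ∀ {_∙_} → Absorbing _∙_ → Uniform _∙_
  absorbing⇒uniform absorb x x′ y = ≈-trans (absorb x y) (≈-sym (absorb x′ y))

  uniform⇒absorbing : ∀ {_∙_} → (∀ y → Σ X (λ x → x ∙ y ≡ y)) → Uniform _∙_ → Absorbing _∙_
  uniform⇒absorbing {_∙_} fixer unif x y =
    let (x′ , x′∙y≡y) = fixer y in ≡.subst (x ∙ y ≈_) x′∙y≡y (unif x x′ y)

  uniform⇔absorbing : ∀ {_∙_} → (∀ y → Σ X (λ x → x ∙ y ≡ y)) → Uniform _∙_ ⇔ Absorbing _∙_
  uniform⇔absorbing fixer = mk⇔ (uniform⇒absorbing fixer) absorbing⇒uniform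

proposition3p4 : {X : Set} (S : Solution X)
    → (∀ x → Σ X (λ y → Solution.σ S y x ≡ x))
    → (∀ x → Σ X (λ y → Solution.τ S y x ≡ x))
    → MultipermutationLevel≤2 S ⇔ TwoReductive S
proposition3p4 S σ-fixer τ-fixer =
  ⇔-trans (mpl≤2⇔uniform S)
    (⇔-trans (uniform⇔absorbing S σ-fixer ×-⇔ uniform⇔absorbing S τ-fixer)
      (⇔-sym (twoReductive⇔absorbing S)))
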